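{- Let $W$ be a balanced word. The following are equivalent: (i) $W$ is reduced; (ii) $W$ does not contain a subword of the form $RL^nR$ with $n\ge 2$; (iii) $W=L^a(RL)^{k_1}R(RL)^{k_2}R\cdots(RL)^{k_m}RL^b$ for some integers $a,b,m\ge 0$ with $a+b=m$ and $k_i\ge 0$ for $1\le i\le m$.
   Context: Words are finite products of the letters $L$ and $R$ (possibly empty); a subword of $a_1\cdots a_n$ is a word $a_k\cdots a_l$ with $1\le k\le l\le n$. A word is balanced if $L$ and $R$ occur in it equally many times. A word is prime if it is nonempty, balanced, and not a product of two nonempty balanced words. For a word $W=a_1\cdots a_n$ and $0\le k\le n$, $e_k(W)=\sum_{i=1}^k\overline{a_i}$ with $\overline{R}=1$, $\overline{L}=-1$. A prime $P$ of length $l(P)$ is an upper prime if $e_k(P)>0$ for $1\le k\le l(P)-1$, and a lower prime if $e_k(P)<0$ for $1\le k\le l(P)-1$. A word is reduced if it does not contain a subword of the form $UD$ with $U$ an upper prime and $D$ a lower prime. -}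

module Defs where

open import Data.Nat using (ℕ; zero; suc; _+_; _≤_; _<_)
open import Data.Integer as ℤ using (ℤ; +_; -[1+_])
open import Data.List using (List; []; _∷_; _++_; length; take; replicate; map; concat)
open import Data.Vec as Vec using (Vec)
open import Data.Product using (Σ; ∃; ∃-syntax; _×_; _,_)
open import Relation.Binary.PropositionalEquality using (_≡_; _≢_)
open import Relation.Nullary using (¬_)

data Letter : Set where
  L R : Letter

Word : Set
Word = List Letter

countL : Word → ℕ
countL []       = 0
countL (L ∷ w)  = suc (countL w)
countL (R ∷ w)  = countL w

countR : Word → ℕ
countR []       = 0
countR (L ∷ w)  = countR w
countR (R ∷ w)  = suc (countR w)

Balanced : Word → Set
Balanced w = countL w ≡ countR w

Prime : Word → Set
Prime w = w ≢ [] × Balanced w ×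
  ¬ (∃[ u ] ∃[ v ] (u ≢ [] × v ≢ [] × Balanced u × Balanced v × w ≡ u ++ v))

bar : Letter → ℤ
bar L = -[1+ 0 ]
bar R = + 1

sumℤ : List ℤ → ℤ
sumℤ []       = + 0
sumℤ (x ∷ xs) = x ℤ.+ sumℤ xs

e : ℕ → Word → ℤ
e k w = sumℤ (map bar (take k w))

UpperPrime : Word → Set
UpperPrime P = Prime P × (∀ k → 1 ≤ k → suc k ≤ length P → + 0 ℤ.< e k P)

LowerPrime : Word → Set
LowerPrime P = Prime P × (∀ k → 1 ≤ k → suc k ≤ length P → e k P ℤ.< + 0)

-- S is a subword of W: S = a_k ... a_l with 1 ≤ k ≤ l ≤ n (so S is nonempty).
Subword : Word → Word → Set
Subword S W = S ≢ [] × ∃[ u ] ∃[ v ] (W ≡ u ++ S ++ v)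

Reduced : Word → Set
Reduced W = ¬ (∃[ U ] ∃[ D ] (UpperPrime U × LowerPrime D × Subword (U ++ D) W))

NoRLnR : Word → Set
NoRLnR W = ¬ (∃[ n ] (2 ≤ n × Subword (R ∷ replicate n L ++ R ∷ []) W))

block : ℕ → Word
block k = concat (replicate k (R ∷ L ∷ [])) ++ R ∷ []

NormalForm : Word → Set
NormalForm W = ∃[ a ] ∃[ b ] ∃[ m ] Σ (Vec ℕ m) λ ks →
  a + b ≡ m × W ≡ replicate a L ++ concat (map block (Vec.toList ks)) ++ replicate b L

-- Write h(w) (weight below) for the sum of the letter values of w, so that e_k(W) = h(a_1⋯a_k).
-- Occurrences of R L^n R with n ≥ 2 are detected by a five-state automaton; a run that never
-- reaches the accepting state is read off as L^a (RL)^{k_1} R ⋯ (RL)^{k_m} R L^b, and h = 0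
-- forces a + b = m. An upper prime has the form R⋯L and a lower prime L⋯R, so UD contains
-- R L L ⋯ R and the automaton accepts it. Conversely let p R L^{m+2} R s be balanced, so
-- h(p) + h(s) = m. If h(p) = a ≥ 0 and h(s) = b ≥ 0, cut the block of L's after a + 1 letters:
-- on the right, the shortest prefix of L L^b R s climbing back to height 0 is a lower prime D,
-- and on the left, reading backwards, an upper prime U ends at the cut. If h(p) < 0 take U = RL
-- (and D as before with b = m); if h(s) < 0 take D = LR.
module Submission where

open import Defs
open import Data.Product using (_×_; ∃-syntax; _,_)
open import Function.Bundles using (_⇔_; mk⇔)

open import Data.Empty using (⊥-elim)
open import Data.Integer
  using (ℤ; +_; -[1+_]; _⊖_; _+_; _-_; -_; _≤_; _<_; +≤+; +<+; -≤+)
import Data.Integer.Properties as ℤP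
open import Algebra.Properties.AbelianGroup ℤP.+-0-abelianGroup
  using (inverseˡ-unique; inverseʳ-unique)
open import Data.Integer.Tactic.RingSolver using (solve-∀)
open import Data.List
  using (List; []; _∷_; _++_; _∷ʳ_; length; take; drop; replicate; map; concat; reverse; foldl;
         initLast; _∷ʳ′_)
open import Data.List.Properties
  using (++-assoc; ++-identityʳ; ++-conicalˡ; ++-conicalʳ; foldl-++; unfold-reverse; reverse-++;
         reverse-involutive; reverse-injective; take++drop≡id)
open import Data.Nat as ℕ using (ℕ; zero; suc; z≤n; s≤s)
import Data.Nat.Properties as ℕP
open import Data.Unit using (⊤; tt)
import Data.Vec as Vec
open import Data.Vec.Properties using (toList∘fromList)
open import Function.Base using (_∘_)
open import Relation.Binary.PropositionalEquality
  using (_≡_; _≢_; refl; sym; trans; cong; cong₂; subst; subst₂; module ≡-Reasoning)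
open ≡-Reasoning

replicate-∷ʳ : ∀ n (x : Letter) → replicate n x ∷ʳ x ≡ x ∷ replicate n x
replicate-∷ʳ zero    x = refl
replicate-∷ʳ (suc n) x = cong (x ∷_) (replicate-∷ʳ n x)

reverse-replicate : ∀ n (x : Letter) → reverse (replicate n x) ≡ replicate n x
reverse-replicate zero    x = refl
reverse-replicate (suc n) x = begin
  reverse (x ∷ replicate n x)  ≡⟨ unfold-reverse x (replicate n x) ⟩
  reverse (replicate n x) ∷ʳ x ≡⟨ cong (_∷ʳ x) (reverse-replicate n x) ⟩
  replicate n x ∷ʳ x           ≡⟨ replicate-∷ʳ n x ⟩
  x ∷ replicate n x            ∎

reverse-≢[] : ∀ {w : Word} → w ≢ [] → reverse w ≢ []
reverse-≢[] w≢[] = w≢[] ∘ reverse-injective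

take-length-++ : ∀ (u v : Word) → take (length u) (u ++ v) ≡ u
take-length-++ []      v = refl
take-length-++ (c ∷ u) v = cong (c ∷_) (take-length-++ u v)

length-<-++ : ∀ (u : Word) {c v} → length u ℕ.< length (u ++ c ∷ v)
length-<-++ []      = s≤s z≤n
length-<-++ (_ ∷ u) = s≤s (length-<-++ u)

take≢[] : ∀ k (w : Word) → 1 ℕ.≤ k → w ≢ [] → take k w ≢ []
take≢[] (suc k) []      _ w≢[] = ⊥-elim (w≢[] refl)
take≢[] (suc k) (c ∷ w) _ _    = λ ()

drop≢[] : ∀ k (w : Word) → k ℕ.< length w → drop k w ≢ []
drop≢[] zero    (c ∷ w) _         = λ ()
drop≢[] (suc k) (c ∷ w) (s≤s k<n) = drop≢[] k w k<n

weight : Word → ℤ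
weight w = sumℤ (map bar w)

weight-++ : ∀ u v → weight (u ++ v) ≡ weight u + weight v
weight-++ []      v = sym (ℤP.+-identityˡ (weight v))
weight-++ (c ∷ u) v = begin
  bar c + weight (u ++ v)       ≡⟨ cong (_+_ (bar c)) (weight-++ u v) ⟩
  bar c + (weight u + weight v) ≡⟨ ℤP.+-assoc (bar c) (weight u) (weight v) ⟨
  bar c + weight u + weight v   ∎

weight-reverse : ∀ w → weight (reverse w) ≡ weight w
weight-reverse []      = refl
weight-reverse (c ∷ w) = begin
  weight (reverse (c ∷ w))         ≡⟨ cong weight (unfold-reverse c w) ⟩
  weight (reverse w ∷ʳ c)          ≡⟨ weight-++ (reverse w) (c ∷ []) ⟩
  weight (reverse w) + (bar c + + 0) ≡⟨ cong₂ _+_ (weight-reverse w) (ℤP.+-identityʳ (bar c)) ⟩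
  weight w + bar c                 ≡⟨ ℤP.+-comm (weight w) (bar c) ⟩
  weight (c ∷ w)                   ∎

weight-replicate-L : ∀ n → weight (replicate n L) ≡ - + n
weight-replicate-L zero          = refl
weight-replicate-L (suc zero)    = refl
weight-replicate-L (suc (suc n)) = cong (_+_ (-[1+ 0 ])) (weight-replicate-L (suc n))

weight≡countR⊖countL : ∀ w → weight w ≡ countR w ⊖ countL w
weight≡countR⊖countL []      = refl
weight≡countR⊖countL (L ∷ w) =
  trans (cong (_+_ (-[1+ 0 ])) (weight≡countR⊖countL w)) (ℤP.distribʳ-⊖-+-neg 0 (countR w) (countL w))
weight≡countR⊖countL (R ∷ w) =
  trans (cong (_+_ (+ 1)) (weight≡countR⊖countL w)) (ℤP.distribʳ-⊖-+-pos 1 (countR w) (countL w))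

balanced⇒weight≡0 : ∀ w → Balanced w → weight w ≡ + 0
balanced⇒weight≡0 w bal =
  trans (weight≡countR⊖countL w)
        (subst (λ n → countR w ⊖ n ≡ + 0) (sym bal) (ℤP.n⊖n≡0 (countR w)))

weight≡0⇒balanced : ∀ w → weight w ≡ + 0 → Balanced w
weight≡0⇒balanced w w≡0 = sym (ℤP.+-injective (ℤP.i-j≡0⇒i≡j (+ countR w) (+ countL w)
  (trans (ℤP.m-n≡m⊖n (countR w) (countL w)) (trans (sym (weight≡countR⊖countL w)) w≡0))))

+-cancelˡ-≤ : ∀ i {j k} → i + j ≤ i + k → j ≤ k
+-cancelˡ-≤ i {j} {k} i+j≤i+k =
  subst₂ _≤_ (-i+[i+j]≡j i j) (-i+[i+j]≡j i k) (ℤP.+-monoʳ-≤ (- i) i+j≤i+k)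
  where
  -i+[i+j]≡j : ∀ i j → - i + (i + j) ≡ j
  -i+[i+j]≡j = solve-∀

+-nonpositiveˡ-≤ : ∀ {i j k} → i ≤ + 0 → i + j ≡ k → k ≤ j
+-nonpositiveˡ-≤ {i} {j} i≤0 refl = subst (i + j ≤_) (ℤP.+-identityˡ j) (ℤP.+-monoˡ-≤ j i≤0)

-- Upper and lower primes as excursions

Excursion : (ℤ → Set) → Word → Set
Excursion Side D = D ≢ [] × weight D ≡ + 0 ×
  (∀ u v → D ≡ u ++ v → u ≢ [] → v ≢ [] → Side (weight u))

NegativeExcursion : Word → Set
NegativeExcursion = Excursion (_< + 0)

PositiveExcursion : Word → Set
PositiveExcursion = Excursion (+ 0 <_)

excursion⇒prime : ∀ {Side D} → (∀ {x} → Side x → x ≢ + 0) → Excursion Side D → Prime D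
excursion⇒prime {D = D} off-axis (D≢[] , D≡0 , side) =
  D≢[] , weight≡0⇒balanced D D≡0 ,
  λ { (u , v , u≢[] , v≢[] , bal-u , _ , D≡uv) →
        off-axis (side u v D≡uv u≢[] v≢[]) (balanced⇒weight≡0 u bal-u) }

excursion-profile : ∀ {Side D} → Excursion Side D →
  ∀ k → 1 ℕ.≤ k → suc k ℕ.≤ length D → Side (e k D)
excursion-profile {D = D} (D≢[] , _ , side) k 1≤k k<length =
  side (take k D) (drop k D) (sym (take++drop≡id k D)) (take≢[] k D 1≤k D≢[]) (drop≢[] k D k<length)

profile⇒excursion : ∀ {Side D} → Prime D →
  (∀ k → 1 ℕ.≤ k → suc k ℕ.≤ length D → Side (e k D)) → Excursion Side D
profile⇒excursion {Side} {D} (D≢[] , bal , _) profile = D≢[] , balanced⇒weight≡0 D bal , prefixes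
  where
  prefixes : ∀ u v → D ≡ u ++ v → u ≢ [] → v ≢ [] → Side (weight u)
  prefixes []      _       _    u≢[] _    = ⊥-elim (u≢[] refl)
  prefixes _       []      _    _    v≢[] = ⊥-elim (v≢[] refl)
  prefixes (c ∷ u) (d ∷ v) refl _    _    =
    subst (Side ∘ weight) (take-length-++ (c ∷ u) (d ∷ v))
      (profile (suc (length u)) (s≤s z≤n) (length-<-++ (c ∷ u)))

negativeExcursion⇒lowerPrime : ∀ {D} → NegativeExcursion D → LowerPrime D
negativeExcursion⇒lowerPrime down =
  excursion⇒prime {_< + 0} ℤP.<⇒≢ down , excursion-profile {_< + 0} down

positiveExcursion⇒upperPrime : ∀ {U} → PositiveExcursion U → UpperPrime U
positiveExcursion⇒upperPrime up =
  excursion⇒prime {+ 0 <_} (λ 0<x → ℤP.<⇒≢ 0<x ∘ sym) up , excursion-profile {+ 0 <_} up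

lowerPrime⇒negativeExcursion : ∀ {D} → LowerPrime D → NegativeExcursion D
lowerPrime⇒negativeExcursion (prime , below) = profile⇒excursion {_< + 0} prime below

upperPrime⇒positiveExcursion : ∀ {U} → UpperPrime U → PositiveExcursion U
upperPrime⇒positiveExcursion (prime , above) = profile⇒excursion {+ 0 <_} prime above

reverse-negativeExcursion : ∀ {D} → NegativeExcursion D → PositiveExcursion (reverse D)
reverse-negativeExcursion {D} (D≢[] , D≡0 , below) =
  reverse-≢[] D≢[] , trans (weight-reverse D) D≡0 , above
  where
  above : ∀ u v → reverse D ≡ u ++ v → u ≢ [] → v ≢ [] → + 0 < weight u
  above u v rD≡uv u≢[] v≢[] =
    subst (+ 0 <_) (sym u≡-v) (ℤP.neg-mono-< (below (reverse v) (reverse u) D≡vu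
      (reverse-≢[] v≢[]) (reverse-≢[] u≢[])))
    where
    D≡vu : D ≡ reverse v ++ reverse u
    D≡vu = trans (sym (reverse-involutive D)) (trans (cong reverse rD≡uv) (reverse-++ u v))
    u≡-v : weight u ≡ - weight (reverse v)
    u≡-v = inverseʳ-unique (weight (reverse v)) (weight u) (begin
      weight (reverse v) + weight u           ≡⟨ cong (_+_ (weight (reverse v))) (weight-reverse u) ⟨
      weight (reverse v) + weight (reverse u) ≡⟨ weight-++ (reverse v) (reverse u) ⟨
      weight (reverse v ++ reverse u)         ≡⟨ cong weight D≡vu ⟨
      weight D                                ≡⟨ D≡0 ⟩
      + 0                                     ∎)

weight-singleton≢0 : ∀ c → weight (c ∷ []) ≢ + 0
weight-singleton≢0 L ()
weight-singleton≢0 R ()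

excursion-ends : ∀ {Side D} → Excursion Side D →
  ∃[ a ] ∃[ x ] ∃[ b ] (D ≡ a ∷ x ++ b ∷ [] × Side (bar a) × Side (- bar b))
excursion-ends {Side} {D} (D≢[] , D≡0 , side) with initLast D
... | []            = ⊥-elim (D≢[] refl)
... | [] ∷ʳ′ c      = ⊥-elim (weight-singleton≢0 c D≡0)
... | (a ∷ x) ∷ʳ′ b =
  a , x , b , refl ,
  subst Side (ℤP.+-identityʳ (bar a))
    (side (a ∷ []) (x ∷ʳ b) refl (λ ()) ((λ ()) ∘ ++-conicalʳ x _)) ,
  subst Side last-letter (side (a ∷ x) (b ∷ []) refl (λ ()) (λ ()))
  where
  last-letter : weight (a ∷ x) ≡ - bar b
  last-letter = trans (inverseˡ-unique (weight (a ∷ x)) (weight (b ∷ []))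
                         (trans (sym (weight-++ (a ∷ x) (b ∷ []))) D≡0))
                      (cong -_ (ℤP.+-identityʳ (bar b)))

-- First passage

StaysBelow : ℤ → Word → Set
StaysBelow h q = ∀ u v → q ≡ u ++ v → v ≢ [] → weight u < h

staysBelow-[] : ∀ {h} → StaysBelow h []
staysBelow-[] [] [] refl []≢[] = ⊥-elim ([]≢[] refl)

staysBelow-∷ : ∀ c {h q} → + 0 < bar c + h → StaysBelow h q → StaysBelow (bar c + h) (c ∷ q)
staysBelow-∷ c 0<h below []      _ _    _    = 0<h
staysBelow-∷ c 0<h below (_ ∷ u) v refl v≢[] = ℤP.+-monoʳ-< (bar c) (below u v refl v≢[])

firstPassage : ∀ n t → + n ≤ weight t →
  ∃[ q ] ∃[ r ] (t ≡ q ++ r × weight q ≡ + n × StaysBelow (+ n) q)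
firstPassage zero    t       _ = [] , t , refl , refl , staysBelow-[]
firstPassage (suc n) []      (+≤+ ())
firstPassage (suc n) (R ∷ t) n≤t with firstPassage n t (+-cancelˡ-≤ (+ 1) n≤t)
... | q , r , refl , q≡n , below =
  R ∷ q , r , refl , cong (_+_ (+ 1)) q≡n , staysBelow-∷ R (+<+ (s≤s z≤n)) below
firstPassage (suc n) (L ∷ t) n≤t with firstPassage (suc (suc n)) t (+-cancelˡ-≤ -[1+ 0 ] n≤t)
... | q , r , refl , q≡n , below =
  L ∷ q , r , refl , cong (_+_ -[1+ 0 ]) q≡n , staysBelow-∷ L (+<+ (s≤s z≤n)) below

negativeExcursion-L∷ : ∀ {q} → weight q ≡ + 1 → StaysBelow (+ 1) q → NegativeExcursion (L ∷ q)
negativeExcursion-L∷ {q} q≡1 below = (λ ()) , cong (_+_ -[1+ 0 ]) q≡1 , prefixes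
  where
  prefixes : ∀ u v → L ∷ q ≡ u ++ v → u ≢ [] → v ≢ [] → weight u < + 0
  prefixes []      _ _    u≢[] _    = ⊥-elim (u≢[] refl)
  prefixes (L ∷ u) v refl _    v≢[] = ℤP.+-monoʳ-< -[1+ 0 ] (below u v refl v≢[])

LR-negativeExcursion : NegativeExcursion (L ∷ R ∷ [])
LR-negativeExcursion = negativeExcursion-L∷ refl (staysBelow-∷ R {+ 0} (+<+ (s≤s z≤n)) staysBelow-[])

RL-positiveExcursion : PositiveExcursion (R ∷ L ∷ [])
RL-positiveExcursion = reverse-negativeExcursion LR-negativeExcursion

weight-LᵏR-positive : ∀ k s → + k ≤ weight s → + 1 ≤ weight (replicate k L ++ R ∷ s)
weight-LᵏR-positive k s k≤s =
  subst₂ _≤_ (-k+[1+k]≡1 (+ k)) (sym weight-LᵏR)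
    (ℤP.+-monoʳ-≤ (- + k) (ℤP.+-monoʳ-≤ (+ 1) k≤s))
  where
  -k+[1+k]≡1 : ∀ k → - k + (+ 1 + k) ≡ + 1
  -k+[1+k]≡1 = solve-∀
  weight-LᵏR : weight (replicate k L ++ R ∷ s) ≡ - + k + (+ 1 + weight s)
  weight-LᵏR = trans (weight-++ (replicate k L) (R ∷ s)) (cong (_+ (+ 1 + weight s)) (weight-replicate-L k))

negativeExcursion-at : ∀ k s → + k ≤ weight s →
  ∃[ D ] ∃[ r ] (L ∷ replicate k L ++ R ∷ s ≡ D ++ r × NegativeExcursion D)
negativeExcursion-at k s k≤s with firstPassage 1 (replicate k L ++ R ∷ s) (weight-LᵏR-positive k s k≤s)
... | q , r , t≡qr , q≡1 , below = L ∷ q , r , cong (L ∷_) t≡qr , negativeExcursion-L∷ q≡1 below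

reverse-pRLᵏ⁺¹ : ∀ k p →
  reverse (p ++ R ∷ replicate (suc k) L) ≡ L ∷ replicate k L ++ R ∷ reverse p
reverse-pRLᵏ⁺¹ k p = begin
  reverse (p ++ R ∷ Lᵏ⁺¹)
    ≡⟨ reverse-++ p (R ∷ Lᵏ⁺¹) ⟩
  reverse (R ∷ Lᵏ⁺¹) ++ reverse p
    ≡⟨ cong (_++ reverse p) (unfold-reverse R Lᵏ⁺¹) ⟩
  (reverse Lᵏ⁺¹ ∷ʳ R) ++ reverse p
    ≡⟨ cong (λ w → (w ∷ʳ R) ++ reverse p) (reverse-replicate (suc k) L) ⟩
  (Lᵏ⁺¹ ∷ʳ R) ++ reverse p
    ≡⟨ ++-assoc Lᵏ⁺¹ (R ∷ []) (reverse p) ⟩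
  L ∷ replicate k L ++ R ∷ reverse p ∎
  where
  Lᵏ⁺¹ : Word
  Lᵏ⁺¹ = replicate (suc k) L

positiveExcursion-at : ∀ k p → + k ≤ weight p →
  ∃[ P ] ∃[ U ] (p ++ R ∷ replicate (suc k) L ≡ P ++ U × PositiveExcursion U)
positiveExcursion-at k p k≤p
  with negativeExcursion-at k (reverse p) (subst (+ k ≤_) (sym (weight-reverse p)) k≤p)
... | D , r , eq , down = reverse r , reverse D , (begin
  p ++ R ∷ replicate (suc k) L                     ≡⟨ reverse-involutive _ ⟨
  reverse (reverse (p ++ R ∷ replicate (suc k) L)) ≡⟨ cong reverse (reverse-pRLᵏ⁺¹ k p) ⟩
  reverse (L ∷ replicate k L ++ R ∷ reverse p)     ≡⟨ cong reverse eq ⟩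
  reverse (D ++ r)                                 ≡⟨ reverse-++ D r ⟩
  reverse r ++ reverse D                           ∎) , reverse-negativeExcursion down

-- An automaton detecting R L^n R with n ≥ 2

data Scan : Set where
  start seenR seenRL seenRLL found : Scan

step : Scan → Letter → Scan
step start   L = start
step start   R = seenR
step seenR   L = seenRL
step seenR   R = seenR
step seenRL  L = seenRLL
step seenRL  R = seenR
step seenRLL L = seenRLL
step seenRLL R = found
step found   _ = found

scan : Scan → Word → Scan
scan = foldl step

ContainsRLⁿR : Word → Set
ContainsRLⁿR W = ∃[ n ] (2 ℕ.≤ n × Subword (R ∷ replicate n L ++ R ∷ []) W)

containsRLⁿR-++ : ∀ p w → ContainsRLⁿR p → ContainsRLⁿR (p ++ w)
containsRLⁿR-++ _ w (n , 2≤n , pattern≢[] , u , v , refl) =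
  n , 2≤n , pattern≢[] , u , v ++ w ,
  trans (++-assoc u _ w) (cong (u ++_) (++-assoc (R ∷ replicate n L ++ R ∷ []) v w))

-- What the state reached after reading p says about p.
Invariant : Scan → Word → Set
Invariant start   _ = ⊤
Invariant seenR   p = ∃[ p′ ] (p ≡ p′ ++ R ∷ [])
Invariant seenRL  p = ∃[ p′ ] (p ≡ p′ ++ R ∷ L ∷ [])
Invariant seenRLL p = ∃[ p′ ] ∃[ k ] (p ≡ p′ ++ R ∷ replicate (2 ℕ.+ k) L)
Invariant found   p = ContainsRLⁿR p

invariant-step : ∀ s c p → Invariant s p → Invariant (step s c) (p ∷ʳ c)
invariant-step start   L p _ = tt
invariant-step start   R p _ = p , refl
invariant-step seenR   L _ (p′ , refl) = p′ , ++-assoc p′ (R ∷ []) (L ∷ [])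
invariant-step seenR   R p _ = p , refl
invariant-step seenRL  L _ (p′ , refl) = p′ , 0 , ++-assoc p′ (R ∷ L ∷ []) (L ∷ [])
invariant-step seenRL  R p _ = p , refl
invariant-step seenRLL L _ (p′ , k , refl) = p′ , suc k ,
  trans (++-assoc p′ (R ∷ replicate (2 ℕ.+ k) L) (L ∷ []))
        (cong (λ w → p′ ++ R ∷ w) (replicate-∷ʳ (2 ℕ.+ k) L))
invariant-step seenRLL R _ (p′ , k , refl) = 2 ℕ.+ k , s≤s (s≤s z≤n) , (λ ()) , p′ , [] ,
  trans (++-assoc p′ (R ∷ replicate (2 ℕ.+ k) L) (R ∷ []))
        (cong (p′ ++_) (sym (++-identityʳ _)))
invariant-step found   c p found-p = containsRLⁿR-++ p (c ∷ []) found-p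

invariant-scan : ∀ s p w → Invariant s p → Invariant (scan s w) (p ++ w)
invariant-scan s p []      inv = subst (Invariant s) (sym (++-identityʳ p)) inv
invariant-scan s p (c ∷ w) inv = subst (Invariant (scan (step s c) w)) (++-assoc p (c ∷ []) w)
  (invariant-scan (step s c) (p ∷ʳ c) w (invariant-step s c p inv))

found⇒RLⁿR : ∀ W → scan start W ≡ found → ContainsRLⁿR W
found⇒RLⁿR W ≡found = subst (λ s → Invariant s W) ≡found (invariant-scan start [] W tt)

scan-found : ∀ w → scan found w ≡ found
scan-found []      = refl
scan-found (_ ∷ w) = scan-found w

step-≢start : ∀ s c → s ≢ start → step s c ≢ start
step-≢start start   _ s≢start = ⊥-elim (s≢start refl)
step-≢start seenR   L _ ()
step-≢start seenR   R _ ()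
step-≢start seenRL  L _ ()
step-≢start seenRL  R _ ()
step-≢start seenRLL L _ ()
step-≢start seenRLL R _ ()
step-≢start found   _ _ ()

step-R-≢start : ∀ s → step s R ≢ start
step-R-≢start start   ()
step-R-≢start seenR   ()
step-R-≢start seenRL  ()
step-R-≢start seenRLL ()
step-R-≢start found   ()

scan-≢start : ∀ s w → s ≢ start → scan s w ≢ start
scan-≢start s []      s≢start = s≢start
scan-≢start s (c ∷ w) s≢start = scan-≢start (step s c) w (step-≢start s c s≢start)

scan-seenRLL-wR : ∀ w → scan seenRLL (w ∷ʳ R) ≡ found
scan-seenRLL-wR []      = refl
scan-seenRLL-wR (L ∷ w) = scan-seenRLL-wR w
scan-seenRLL-wR (R ∷ w) = scan-found (w ∷ʳ R)

scan-LLwR : ∀ s w → s ≢ start → scan s (L ∷ L ∷ w ∷ʳ R) ≡ found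
scan-LLwR start   _ s≢start = ⊥-elim (s≢start refl)
scan-LLwR seenR   w _ = scan-seenRLL-wR w
scan-LLwR seenRL  w _ = scan-seenRLL-wR w
scan-LLwR seenRLL w _ = scan-seenRLL-wR w
scan-LLwR found   w _ = scan-found (w ∷ʳ R)

scan-infix-found : ∀ w → (∀ s → scan s w ≡ found) → ∀ s p q → scan s (p ++ w ++ q) ≡ found
scan-infix-found w finds s p q = begin
  scan s (p ++ w ++ q)           ≡⟨ foldl-++ step s p (w ++ q) ⟩
  scan (scan s p) (w ++ q)       ≡⟨ foldl-++ step (scan s p) w q ⟩
  scan (scan (scan s p) w) q     ≡⟨ cong (λ t → scan t q) (finds (scan s p)) ⟩
  scan found q                   ≡⟨ scan-found q ⟩
  found                          ∎

RLⁿR⇒found : ∀ W → ContainsRLⁿR W → scan start W ≡ found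
RLⁿR⇒found _ (suc (suc k) , s≤s (s≤s z≤n) , _ , p , q , refl) =
  scan-infix-found _ (λ s → scan-LLwR (step s R) (replicate k L) (step-R-≢start s)) start p q

-- (i) ⇐ (ii): every UD contains R L^n R with n ≥ 2

Violation : Word → Set
Violation W = ∃[ U ] ∃[ D ] (UpperPrime U × LowerPrime D × Subword (U ++ D) W)

upperPrime-shape : ∀ {U} → UpperPrime U → ∃[ x ] (U ≡ R ∷ x ∷ʳ L)
upperPrime-shape up with excursion-ends {+ 0 <_} (upperPrime⇒positiveExcursion up)
... | R , x , L , refl , _ , _ = x , refl
... | L , _ , _ , _    , () , _
... | R , _ , R , _    , _ , ()

lowerPrime-shape : ∀ {D} → LowerPrime D → ∃[ y ] (D ≡ L ∷ y ∷ʳ R)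
lowerPrime-shape down with excursion-ends {_< + 0} (lowerPrime⇒negativeExcursion down)
... | L , y , R , refl , _ , _ = y , refl
... | R , _ , _ , _    , +<+ () , _
... | L , _ , L , _    , _ , +<+ ()

scan-UD : ∀ x y s → scan s ((R ∷ x ∷ʳ L) ++ L ∷ y ∷ʳ R) ≡ found
scan-UD x y s = begin
  scan (step s R) ((x ∷ʳ L) ++ L ∷ y ∷ʳ R)
    ≡⟨ cong (scan (step s R)) (++-assoc x (L ∷ []) (L ∷ y ∷ʳ R)) ⟩
  scan (step s R) (x ++ L ∷ L ∷ y ∷ʳ R)
    ≡⟨ foldl-++ step (step s R) x (L ∷ L ∷ y ∷ʳ R) ⟩
  scan (scan (step s R) x) (L ∷ L ∷ y ∷ʳ R)
    ≡⟨ scan-LLwR _ y (scan-≢start (step s R) x (step-R-≢start s)) ⟩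
  found ∎

violation⇒RLⁿR : ∀ W → Violation W → ContainsRLⁿR W
violation⇒RLⁿR _ (U , D , up , down , _ , p , q , refl)
  with upperPrime-shape up | lowerPrime-shape down
... | x , refl | y , refl = found⇒RLⁿR _ (scan-infix-found _ (scan-UD x y) start p q)

-- (i) ⇒ (ii): in a balanced word every R L^n R with n ≥ 2 yields some UD

violation : ∀ {W} P U D r → PositiveExcursion U → NegativeExcursion D →
  W ≡ (P ++ U) ++ (D ++ r) → Violation W
violation P U D r up@(U≢[] , _) down refl =
  U , D , positiveExcursion⇒upperPrime up , negativeExcursion⇒lowerPrime down ,
  U≢[] ∘ ++-conicalˡ U D , P , r ,
  trans (++-assoc P U (D ++ r)) (cong (P ++_) (sym (++-assoc U D r)))

split-RLⁿR : ∀ {a b m} → a ℕ.+ b ≡ m → ∀ p s →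
  p ++ (R ∷ replicate (2 ℕ.+ m) L ++ R ∷ []) ++ s ≡
  (p ++ R ∷ replicate (suc a) L) ++ L ∷ replicate b L ++ R ∷ s
split-RLⁿR {a} {b} refl p s = begin
  p ++ R ∷ (replicate (2 ℕ.+ (a ℕ.+ b)) L ∷ʳ R) ++ s
    ≡⟨ cong (λ w → p ++ R ∷ w) (split-Lⁿ a) ⟩
  p ++ R ∷ replicate (suc a) L ++ L ∷ replicate b L ++ R ∷ s
    ≡⟨ ++-assoc p _ _ ⟨
  (p ++ R ∷ replicate (suc a) L) ++ L ∷ replicate b L ++ R ∷ s ∎
  where
  split-Lⁿ : ∀ a → (replicate (2 ℕ.+ (a ℕ.+ b)) L ∷ʳ R) ++ s ≡
                   replicate (suc a) L ++ L ∷ replicate b L ++ R ∷ s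
  split-Lⁿ zero    = cong (λ w → L ∷ L ∷ w) (++-assoc (replicate b L) (R ∷ []) s)
  split-Lⁿ (suc a) = cong (L ∷_) (split-Lⁿ a)

violation-split : ∀ {a b m} p s → a ℕ.+ b ≡ m →
  ∃[ P ] ∃[ U ] (p ++ R ∷ replicate (suc a) L ≡ P ++ U × PositiveExcursion U) →
  ∃[ D ] ∃[ r ] (L ∷ replicate b L ++ R ∷ s ≡ D ++ r × NegativeExcursion D) →
  Violation (p ++ (R ∷ replicate (2 ℕ.+ m) L ++ R ∷ []) ++ s)
violation-split p s a+b≡m (P , U , left , up) (D , r , right , down) =
  violation P U D r up down (trans (split-RLⁿR a+b≡m p s) (cong₂ _++_ left right))

weight-around-RLⁿR : ∀ p m s →
  weight (p ++ (R ∷ replicate (2 ℕ.+ m) L ++ R ∷ []) ++ s) ≡ weight p + weight s - + m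
weight-around-RLⁿR p m s = begin
  weight (p ++ (R ∷ Lⁿ ++ R ∷ []) ++ s)
    ≡⟨ weight-++ p _ ⟩
  weight p + weight ((R ∷ Lⁿ ++ R ∷ []) ++ s)
    ≡⟨ cong (_+_ (weight p)) (weight-++ (R ∷ Lⁿ ++ R ∷ []) s) ⟩
  weight p + (+ 1 + weight (Lⁿ ++ R ∷ []) + weight s)
    ≡⟨ cong (λ z → weight p + (+ 1 + z + weight s)) (weight-++ Lⁿ (R ∷ [])) ⟩
  weight p + (+ 1 + (weight Lⁿ + (+ 1 + + 0)) + weight s)
    ≡⟨ cong (λ z → weight p + (+ 1 + (z + (+ 1 + + 0)) + weight s)) (weight-replicate-L (2 ℕ.+ m)) ⟩
  weight p + (+ 1 + (- (+ 2 + + m) + (+ 1 + + 0)) + weight s)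
    ≡⟨ rearrange (weight p) (weight s) (+ m) ⟩
  weight p + weight s - + m ∎
  where
  Lⁿ : Word
  Lⁿ = replicate (2 ℕ.+ m) L
  rearrange : ∀ x y m → x + (+ 1 + (- (+ 2 + m) + (+ 1 + + 0)) + y) ≡ x + y - m
  rearrange = solve-∀

violation-around-RLⁿR : ∀ p m s → weight p + weight s ≡ + m →
  Violation (p ++ (R ∷ replicate (2 ℕ.+ m) L ++ R ∷ []) ++ s)
violation-around-RLⁿR p m s sum with weight p in ≡hp | weight s in ≡hs
... | -[1+ _ ] | _ =
  violation-split p s refl (p , R ∷ L ∷ [] , refl , RL-positiveExcursion)
    (negativeExcursion-at m s (subst (+ m ≤_) (sym ≡hs) (+-nonpositiveˡ-≤ -≤+ sum)))
... | + a | -[1+ y ] =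
  violation-split p s (ℕP.+-identityʳ m)
    (positiveExcursion-at m p (subst (+ m ≤_) (sym ≡hp)
      (+-nonpositiveˡ-≤ -≤+ (trans (ℤP.+-comm -[1+ y ] (+ a)) sum))))
    (L ∷ R ∷ [] , s , refl , LR-negativeExcursion)
... | + a | + b =
  violation-split p s (ℤP.+-injective sum)
    (positiveExcursion-at a p (ℤP.≤-reflexive (sym ≡hp)))
    (negativeExcursion-at b s (ℤP.≤-reflexive (sym ≡hs)))

RLⁿR⇒violation : ∀ W → Balanced W → ContainsRLⁿR W → Violation W
RLⁿR⇒violation W bal (suc (suc m) , s≤s (s≤s z≤n) , _ , p , s , refl) =
  violation-around-RLⁿR p m s (ℤP.i-j≡0⇒i≡j _ _
    (trans (sym (weight-around-RLⁿR p m s)) (balanced⇒weight≡0 W bal)))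

-- (ii) ⇔ (iii)

blocks : List ℕ → Word
blocks ks = concat (map block ks)

scan-start-Lᵃ : ∀ a → scan start (replicate a L) ≡ start
scan-start-Lᵃ zero    = refl
scan-start-Lᵃ (suc a) = scan-start-Lᵃ a

-- step s R ≡ seenR holds exactly for the states start, seenR and seenRL met between blocks.
scan-block : ∀ s k → step s R ≡ seenR → scan s (block k) ≡ seenR
scan-block s zero    s-R≡seenR = s-R≡seenR
scan-block s (suc k) s-R≡seenR rewrite s-R≡seenR = scan-block seenRL k refl

scan-blocks : ∀ s ks → step s R ≡ seenR → step (scan s (blocks ks)) R ≡ seenR
scan-blocks s []       s-R≡seenR = s-R≡seenR
scan-blocks s (k ∷ ks) s-R≡seenR rewrite foldl-++ step s (block k) (blocks ks)
                                       | scan-block s k s-R≡seenR = scan-blocks seenR ks refl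

step-R≡seenR⇒≢found : ∀ s → step s R ≡ seenR → s ≢ found
step-R≡seenR⇒≢found start   _  ()
step-R≡seenR⇒≢found seenR   _  ()
step-R≡seenR⇒≢found seenRL  _  ()
step-R≡seenR⇒≢found seenRLL ()
step-R≡seenR⇒≢found found   ()

scan-Lᵇ-≢found : ∀ s b → s ≢ found → scan s (replicate b L) ≢ found
scan-Lᵇ-≢found s       zero    s≢found = s≢found
scan-Lᵇ-≢found start   (suc b) _       = scan-Lᵇ-≢found start b (λ ())
scan-Lᵇ-≢found seenR   (suc b) _       = scan-Lᵇ-≢found seenRL b (λ ())
scan-Lᵇ-≢found seenRL  (suc b) _       = scan-Lᵇ-≢found seenRLL b (λ ())
scan-Lᵇ-≢found seenRLL (suc b) _       = scan-Lᵇ-≢found seenRLL b (λ ())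
scan-Lᵇ-≢found found   (suc b) s≢found = ⊥-elim (s≢found refl)

normalForm⇒unmatched : ∀ W → NormalForm W → scan start W ≢ found
normalForm⇒unmatched _ (a , b , _ , ks , _ , refl) = scan-Lᵇ-≢found (scan start C) b
  (step-R≡seenR⇒≢found _ (scan-blocks start (Vec.toList ks) refl)) ∘ trans (sym scan-W)
  where
  C : Word
  C = blocks (Vec.toList ks)
  scan-W : scan start (replicate a L ++ C ++ replicate b L) ≡ scan (scan start C) (replicate b L)
  scan-W = begin
    scan start (replicate a L ++ C ++ replicate b L)
      ≡⟨ foldl-++ step start (replicate a L) _ ⟩
    scan (scan start (replicate a L)) (C ++ replicate b L)
      ≡⟨ cong (λ t → scan t (C ++ replicate b L)) (scan-start-Lᵃ a) ⟩
    scan start (C ++ replicate b L)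
      ≡⟨ foldl-++ step start C (replicate b L) ⟩
    scan (scan start C) (replicate b L) ∎

unmatched-seenRLL : ∀ w → scan seenRLL w ≢ found → ∃[ j ] (w ≡ replicate j L)
unmatched-seenRLL []      _         = 0 , refl
unmatched-seenRLL (L ∷ w) unmatched with unmatched-seenRLL w unmatched
... | j , refl = suc j , refl
unmatched-seenRLL (R ∷ w) unmatched = ⊥-elim (unmatched (scan-found w))

unmatched-seenR : ∀ w → scan seenR w ≢ found →
  ∃[ k ] ∃[ ks ] ∃[ b ] (R ∷ w ≡ blocks (k ∷ ks) ++ replicate b L)
unmatched-seenR []          _         = 0 , [] , 0 , refl
unmatched-seenR (R ∷ w)     unmatched with unmatched-seenR w unmatched
... | k , ks , b , eq = 0 , k ∷ ks , b , cong (R ∷_) eq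
unmatched-seenR (L ∷ [])    _         = 0 , [] , 1 , refl
unmatched-seenR (L ∷ R ∷ w) unmatched with unmatched-seenR w unmatched
... | k , ks , b , eq = suc k , ks , b , cong (λ v → R ∷ L ∷ v) eq
unmatched-seenR (L ∷ L ∷ w) unmatched with unmatched-seenRLL w unmatched
... | j , refl = 0 , [] , 2 ℕ.+ j , refl

unmatched-start : ∀ W → scan start W ≢ found →
  ∃[ a ] ∃[ ks ] ∃[ b ] (W ≡ replicate a L ++ blocks ks ++ replicate b L)
unmatched-start []      _         = 0 , [] , 0 , refl
unmatched-start (L ∷ W) unmatched with unmatched-start W unmatched
... | a , ks , b , refl = suc a , ks , b , refl
unmatched-start (R ∷ w) unmatched with unmatched-seenR w unmatched
... | k , ks , b , eq = 0 , k ∷ ks , b , eq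

weight-block : ∀ k → weight (block k) ≡ + 1
weight-block zero    = refl
weight-block (suc k) = cong (λ z → + 1 + (-[1+ 0 ] + z)) (weight-block k)

weight-blocks : ∀ ks → weight (blocks ks) ≡ + length ks
weight-blocks []       = refl
weight-blocks (k ∷ ks) =
  trans (weight-++ (block k) (blocks ks)) (cong₂ _+_ (weight-block k) (weight-blocks ks))

weight-LᵃCLᵇ : ∀ a ks b →
  weight (replicate a L ++ blocks ks ++ replicate b L) ≡ + length ks - (+ a + + b)
weight-LᵃCLᵇ a ks b = begin
  weight (replicate a L ++ blocks ks ++ replicate b L)
    ≡⟨ weight-++ (replicate a L) _ ⟩
  weight (replicate a L) + weight (blocks ks ++ replicate b L)
    ≡⟨ cong (_+_ (weight (replicate a L))) (weight-++ (blocks ks) (replicate b L)) ⟩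
  weight (replicate a L) + (weight (blocks ks) + weight (replicate b L))
    ≡⟨ cong₂ (λ x y → x + (weight (blocks ks) + y)) (weight-replicate-L a) (weight-replicate-L b) ⟩
  - + a + (weight (blocks ks) + - + b)
    ≡⟨ cong (λ z → - + a + (z + - + b)) (weight-blocks ks) ⟩
  - + a + (+ length ks + - + b)
    ≡⟨ rearrange (+ a) (+ b) (+ length ks) ⟩
  + length ks - (+ a + + b) ∎
  where
  rearrange : ∀ a b n → - a + (n + - b) ≡ n - (a + b)
  rearrange = solve-∀

unmatched⇒normalForm : ∀ W → Balanced W → scan start W ≢ found → NormalForm W
unmatched⇒normalForm W bal unmatched with unmatched-start W unmatched
... | a , ks , b , refl =
  a , b , length ks , Vec.fromList ks ,
  sym (ℤP.+-injective (ℤP.i-j≡0⇒i≡j _ _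
    (trans (sym (weight-LᵃCLᵇ a ks b)) (balanced⇒weight≡0 W bal)))) ,
  cong (λ ks → replicate a L ++ blocks ks ++ replicate b L) (sym (toList∘fromList ks))

proposition6p4 : (W : Word) → Balanced W →
    (Reduced W ⇔ NoRLnR W) × (NoRLnR W ⇔ NormalForm W)
proposition6p4 W bal =
  mk⇔ (λ reduced → reduced ∘ RLⁿR⇒violation W bal)
      (λ noRLⁿR → noRLⁿR ∘ violation⇒RLⁿR W) ,
  mk⇔ (λ noRLⁿR → unmatched⇒normalForm W bal (noRLⁿR ∘ found⇒RLⁿR W))
      (λ nf → normalForm⇒unmatched W nf ∘ RLⁿR⇒found W)
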